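{- (1) Let $\mathbf E=(E,+,{}',0,1)$ be a lattice effect algebra, let $\mathbb{IL}(\mathbf E)=(E,\rightarrow,0)$ with $x\rightarrow y:=y+(x\vee y)'$, and let $\mathbb{EL}(\mathbb{IL}(\mathbf E))=(E,\oplus,{}^*,0,e)$ be obtained from it by $x^*:=x\rightarrow0$, $e:=0^*$, and $x\oplus y$ defined iff $x\rightarrow y^*=1$, in which case $x\oplus y:=x^*\rightarrow y$. Then $\mathbb{EL}(\mathbb{IL}(\mathbf E))=\mathbf E$, i.e. $\oplus$ is defined exactly when $+$ is and coincides with it, $x^*=x'$ for all $x$, and $e=1$. (2) Let $\mathbf I=(I,\rightarrow,0)$ be a lattice effect implication algebra, let $\mathbb{EL}(\mathbf I)=(I,+,{}',0,1)$ with $x':=x\rightarrow0$, $1:=0'$, and $x+y$ defined iff $x\rightarrow y'=1$, in which case $x+y:=x'\rightarrow y$, and let $\mathbb{IL}(\mathbb{EL}(\mathbf I))=(I,\Rightarrow,0)$ with $x\Rightarrow y:=y+(x\vee y)'$, where $\vee$ is the join in the induced order of $\mathbb{EL}(\mathbf I)$. Then $\mathbb{IL}(\mathbb{EL}(\mathbf I))=\mathbf I$, i.e. $x\Rightarrow y=x\rightarrow y$ for all $x,y\in I$.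
   Context: An effect algebra is a structure $(E,+,{}',0,1)$ where $E$ is a set, ${}'$ is a unary operation on $E$, $0,1\in E$, and $+$ is a partial binary operation on $E$ such that for all $x,y,z\in E$: (E1) if $x+y$ is defined then so is $y+x$ and $x+y=y+x$; (E2) $(x+y)+z$ is defined if and only if $x+(y+z)$ is defined, and then they are equal; (E3) $x+y$ is defined and equals $1$ if and only if $y=x'$; (E4) if $1+x$ is defined then $x=0$. The induced order is $x\leq y$ iff there exists $z$ with $x+z=y$. A lattice effect algebra is an effect algebra whose induced order is a lattice order, with join $\vee$. A lattice effect implication algebra is an algebra $(I,\rightarrow,0)$ with a binary operation $\rightarrow$ and a constant $0$ such that, writing $x':=x\rightarrow0$ and $1:=0'$, for all $x,y,z\in I$: (i) $0\rightarrow x=x\rightarrow x=x\rightarrow1=1$; (ii) if $x\rightarrow y=y\rightarrow x=1$ then $x=y$; (iii) if $x\rightarrow y=y\rightarrow z=1$ then $x\rightarrow z=1$; (iv) if $x\rightarrow y=1$ then $y'\rightarrow x'=1$; (v) $x''=x$; (vi) $x\rightarrow((x\rightarrow y)\rightarrow y)=1$; (vii) $y\rightarrow((x\rightarrow y)\rightarrow y)=1$; (viii) if $x\rightarrow z=y\rightarrow z=1$ then $((x\rightarrow y)\rightarrow y)\rightarrow z=1$; (ix) if $x\rightarrow y=1$ then $y\rightarrow x=x'\rightarrow y'$; (x) [$x\rightarrow y'=1$ and $(x'\rightarrow y)\rightarrow z'=1$] if and only if [$y\rightarrow z'=1$ and $x\rightarrow(y'\rightarrow z)'=1$], and in this case $(x'\rightarrow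 y)'\rightarrow z=x'\rightarrow(y'\rightarrow z)$; (xi) $y'\rightarrow((x\rightarrow y)\rightarrow y)'=x\rightarrow y$; (xii) $x\rightarrow(y\rightarrow x)=1$. It is known that $\mathbb{IL}(\mathbf E)$ is a lattice effect implication algebra for every lattice effect algebra $\mathbf E$ and $\mathbb{EL}(\mathbf I)$ is a lattice effect algebra for every lattice effect implication algebra $\mathbf I$. -}

module Defs where

open import Level using (Level; suc)
open import Data.Maybe using (Maybe; just; nothing)
open import Data.Product using (Σ; Σ-syntax; _×_; _,_)
open import Relation.Binary.PropositionalEquality using (_≡_)
open import Function.Bundles using (_⇔_)

-- Effect algebras. The partial operation + is modelled as a total map
-- into Maybe E: "x + y is defined and equals z" means  x ⊕ y ≡ just z,
-- "x + y is undefined" means  x ⊕ y ≡ nothing.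

-- Kleisli extension of ⊕ to possibly-undefined arguments
-- (used to express axiom (E2) "one side defined iff the other, and then equal").
lift⊕ : ∀ {a} {E : Set a} → (E → E → Maybe E) → Maybe E → Maybe E → Maybe E
lift⊕ _⊕_ (just x) (just y) = x ⊕ y
lift⊕ _⊕_ _        _        = nothing

record LatticeEffectAlgebra (a : Level) : Set (suc a) where
  field
    E    : Set a
    _⊕_  : E → E → Maybe E
    _′   : E → E
    𝟘    : E
    𝟙    : E
    E1 : ∀ x y z → x ⊕ y ≡ just z → y ⊕ x ≡ just z
    E2 : ∀ x y z → lift⊕ _⊕_ (x ⊕ y) (just z) ≡ lift⊕ _⊕_ (just x) (y ⊕ z)
    E3 : ∀ x y → (x ⊕ y ≡ just 𝟙) ⇔ (y ≡ x ′)
    E4 : ∀ x z → 𝟙 ⊕ x ≡ just z → x ≡ 𝟘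

  _≤_ : E → E → Set a
  x ≤ y = Σ[ z ∈ E ] (x ⊕ z ≡ just y)

  field
    _∨_   : E → E → E
    _∧_   : E → E → E
    ∨-ub₁ : ∀ x y → x ≤ (x ∨ y)
    ∨-ub₂ : ∀ x y → y ≤ (x ∨ y)
    ∨-lub : ∀ x y w → x ≤ w → y ≤ w → (x ∨ y) ≤ w
    ∧-lb₁ : ∀ x y → (x ∧ y) ≤ x
    ∧-lb₂ : ∀ x y → (x ∧ y) ≤ y
    ∧-glb : ∀ x y w → w ≤ x → w ≤ y → w ≤ (x ∧ y)

  infixl 6 _⊕_
  infixl 6 _∨_ _∧_

module ILofEA {a} (𝐄 : LatticeEffectAlgebra a) where
  open LatticeEffectAlgebra 𝐄

  -- x → y := y + (x ∨ y)' ; written relationally:  Arr x y z  means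
  -- "y + (x ∨ y)' is defined and x → y = z".
  Arr : E → E → E → Set a
  Arr x y z = y ⊕ ((x ∨ y) ′) ≡ just z

  -- x ⊕ y in EL(IL(E)) is defined and equals z:
  --   x ⊕ y defined iff x → y* = e, where y* = y → 0, e = 0* ;
  --   then x ⊕ y = x* → y.
  OplusEL : E → E → E → Set a
  OplusEL x y z =
    Σ[ s ∈ E ] (Arr y 𝟘 s ×
    Σ[ e ∈ E ] (Arr 𝟘 𝟘 e ×
               (Arr x s e ×
    Σ[ u ∈ E ] (Arr x 𝟘 u ×
               Arr u y z))))

record LatticeEffectImplicationAlgebra (a : Level) : Set (suc a) where
  infixr 5 _⇒_
  field
    I   : Set a
    _⇒_ : I → I → I
    𝟘   : I

  _′ : I → I
  x ′ = x ⇒ 𝟘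

  𝟙 : I
  𝟙 = 𝟘 ′

  field
    ax-i₁  : ∀ x → 𝟘 ⇒ x ≡ 𝟙
    ax-i₂  : ∀ x → x ⇒ x ≡ 𝟙
    ax-i₃  : ∀ x → x ⇒ 𝟙 ≡ 𝟙
    ax-ii  : ∀ x y → x ⇒ y ≡ 𝟙 → y ⇒ x ≡ 𝟙 → x ≡ y
    ax-iii : ∀ x y z → x ⇒ y ≡ 𝟙 → y ⇒ z ≡ 𝟙 → x ⇒ z ≡ 𝟙
    ax-iv  : ∀ x y → x ⇒ y ≡ 𝟙 → (y ′) ⇒ (x ′) ≡ 𝟙
    ax-v   : ∀ x → (x ′) ′ ≡ x
    ax-vi  : ∀ x y → x ⇒ ((x ⇒ y) ⇒ y) ≡ 𝟙
    ax-vii : ∀ x y → y ⇒ ((x ⇒ y) ⇒ y) ≡ 𝟙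
    ax-viii : ∀ x y z → x ⇒ z ≡ 𝟙 → y ⇒ z ≡ 𝟙 → ((x ⇒ y) ⇒ y) ⇒ z ≡ 𝟙
    ax-ix  : ∀ x y → x ⇒ y ≡ 𝟙 → y ⇒ x ≡ (x ′) ⇒ (y ′)
    ax-x₁  : ∀ x y z → (x ⇒ (y ′) ≡ 𝟙 × ((x ′) ⇒ y) ⇒ (z ′) ≡ 𝟙)
                     → (y ⇒ (z ′) ≡ 𝟙 × x ⇒ (((y ′) ⇒ z) ′) ≡ 𝟙)
    ax-x₂  : ∀ x y z → (y ⇒ (z ′) ≡ 𝟙 × x ⇒ (((y ′) ⇒ z) ′) ≡ 𝟙)
                     → (x ⇒ (y ′) ≡ 𝟙 × ((x ′) ⇒ y) ⇒ (z ′) ≡ 𝟙)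
    ax-x₃  : ∀ x y z → x ⇒ (y ′) ≡ 𝟙 → ((x ′) ⇒ y) ⇒ (z ′) ≡ 𝟙
                     → (((x ′) ⇒ y) ′) ⇒ z ≡ (x ′) ⇒ ((y ′) ⇒ z)
    ax-xi  : ∀ x y → (y ′) ⇒ (((x ⇒ y) ⇒ y) ′) ≡ x ⇒ y
    ax-xii : ∀ x y → x ⇒ (y ⇒ x) ≡ 𝟙

module ELofEIA {a} (𝐈 : LatticeEffectImplicationAlgebra a) where
  open LatticeEffectImplicationAlgebra 𝐈

  Sum : I → I → I → Set a
  Sum x y z = (x ⇒ (y ′) ≡ 𝟙) × ((x ′) ⇒ y ≡ z)

  _≤EL_ : I → I → Set a
  x ≤EL y = Σ[ z ∈ I ] Sum x z y

  IsJoin : I → I → I → Set a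
  IsJoin j x y = x ≤EL j × y ≤EL j × (∀ w → x ≤EL w → y ≤EL w → j ≤EL w)

ELIL≡id : ∀ {a} → LatticeEffectAlgebra a → Set a
ELIL≡id 𝐄 =
  (∀ x → Arr x 𝟘 (x ′))
  × Arr 𝟘 𝟘 𝟙
  × (∀ x y z → (x ⊕ y ≡ just z) ⇔ OplusEL x y z)
  where open LatticeEffectAlgebra 𝐄
        open ILofEA 𝐄

ILEL≡id : ∀ {a} → LatticeEffectImplicationAlgebra a → Set a
ILEL≡id 𝐈 = ∀ x y j → IsJoin j x y → Sum y (j ′) (x ⇒ y)
  where open LatticeEffectImplicationAlgebra 𝐈
        open ELofEIA 𝐈

module Submission where

open import Defs
open import Data.Product using (_×_; _,_; ∃)
open import Data.Maybe using (Maybe; just)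
open import Data.Maybe.Properties using (just-injective)
open import Function.Bundles using (_⇔_; mk⇔; Equivalence)
open import Relation.Binary.PropositionalEquality
open ≡-Reasoning

-- In a lattice effect algebra, x → y = y + (x ∨ y)' equals 1 exactly when
-- x ≤ y, and equals y + x' when y ≤ x.  As x + y is defined iff x ≤ y', the
-- condition x → y* = 1 says that x + y is defined, and then y ≤ x' gives
-- x* → y = y + x'' = x + y.  Conversely, in a lattice effect implication
-- algebra x → y = 1 is the induced order of EL(I), whose join is (x → y) → y
-- by axioms (vi)-(viii); axioms (vii) and (xi) then say precisely that
-- y + ((x → y) → y)' is defined and equals x → y.

lift⊕-justˡ-inv : ∀ {a} {E : Set a} (_⊕_ : E → E → Maybe E) {x v : E} m →
                  lift⊕ _⊕_ (just x) m ≡ just v → ∃ λ d → m ≡ just d × x ⊕ d ≡ just v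
lift⊕-justˡ-inv _ (just d) eq = d , refl , eq

lift⊕-justʳ-inv : ∀ {a} {E : Set a} (_⊕_ : E → E → Maybe E) {z v : E} m →
                  lift⊕ _⊕_ m (just z) ≡ just v → ∃ λ w → m ≡ just w × w ⊕ z ≡ just v
lift⊕-justʳ-inv _ (just w) eq = w , refl , eq

module LatticeEffectAlgebraProperties {a} (𝐄 : LatticeEffectAlgebra a) where
  open LatticeEffectAlgebra 𝐄
  open ILofEA 𝐄
  open Equivalence

  ⊕-comm : ∀ {x y z} → x ⊕ y ≡ just z → y ⊕ x ≡ just z
  ⊕-comm = E1 _ _ _

  ⊕-assocʳ : ∀ {x y z w v} → x ⊕ y ≡ just w → w ⊕ z ≡ just v →
             ∃ λ d → y ⊕ z ≡ just d × x ⊕ d ≡ just v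
  ⊕-assocʳ {x} {y} {z} {w} {v} x⊕y w⊕z = lift⊕-justˡ-inv _⊕_ (y ⊕ z) (begin
    lift⊕ _⊕_ (just x) (y ⊕ z)  ≡⟨ sym (E2 x y z) ⟩
    lift⊕ _⊕_ (x ⊕ y) (just z)  ≡⟨ cong (λ m → lift⊕ _⊕_ m (just z)) x⊕y ⟩
    w ⊕ z                       ≡⟨ w⊕z ⟩
    just v                      ∎)

  ⊕-assocˡ : ∀ {x y z d v} → y ⊕ z ≡ just d → x ⊕ d ≡ just v →
             ∃ λ w → x ⊕ y ≡ just w × w ⊕ z ≡ just v
  ⊕-assocˡ {x} {y} {z} {d} {v} y⊕z x⊕d = lift⊕-justʳ-inv _⊕_ (x ⊕ y) (begin
    lift⊕ _⊕_ (x ⊕ y) (just z)  ≡⟨ E2 x y z ⟩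
    lift⊕ _⊕_ (just x) (y ⊕ z)  ≡⟨ cong (lift⊕ _⊕_ (just x)) y⊕z ⟩
    x ⊕ d                       ≡⟨ x⊕d ⟩
    just v                      ∎)

  x⊕x′≡𝟙 : ∀ x → x ⊕ x ′ ≡ just 𝟙
  x⊕x′≡𝟙 x = from (E3 x (x ′)) refl

  x′⊕x≡𝟙 : ∀ x → x ′ ⊕ x ≡ just 𝟙
  x′⊕x≡𝟙 x = ⊕-comm (x⊕x′≡𝟙 x)

  ⊕≡𝟙⇒≡′ : ∀ {x y} → x ⊕ y ≡ just 𝟙 → y ≡ x ′
  ⊕≡𝟙⇒≡′ = to (E3 _ _)

  ′-involutive : ∀ x → x ′ ′ ≡ x
  ′-involutive x = sym (⊕≡𝟙⇒≡′ (x′⊕x≡𝟙 x))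

  ′-injective : ∀ {x y} → x ′ ≡ y ′ → x ≡ y
  ′-injective {x} {y} x′≡y′ = begin
    x      ≡⟨ sym (′-involutive x) ⟩
    x ′ ′  ≡⟨ cong _′ x′≡y′ ⟩
    y ′ ′  ≡⟨ ′-involutive y ⟩
    y      ∎

  𝟙′≡𝟘 : 𝟙 ′ ≡ 𝟘
  𝟙′≡𝟘 = E4 (𝟙 ′) 𝟙 (x⊕x′≡𝟙 𝟙)

  x⊕𝟘≡x : ∀ x → x ⊕ 𝟘 ≡ just x
  x⊕𝟘≡x x = subst (λ t → t ⊕ 𝟘 ≡ just t) (′-involutive x) (x′⊕𝟘≡x′ (x ′))
    where
    𝟙⊕𝟘≡𝟙 : 𝟙 ⊕ 𝟘 ≡ just 𝟙
    𝟙⊕𝟘≡𝟙 = subst (λ t → 𝟙 ⊕ t ≡ just 𝟙) 𝟙′≡𝟘 (x⊕x′≡𝟙 𝟙)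

    x′⊕𝟘≡x′ : ∀ y → y ′ ⊕ 𝟘 ≡ just (y ′)
    x′⊕𝟘≡x′ y with ⊕-assocʳ (x⊕x′≡𝟙 y) 𝟙⊕𝟘≡𝟙
    ... | d , y′⊕𝟘≡d , y⊕d≡𝟙 = subst (λ t → y ′ ⊕ 𝟘 ≡ just t) (⊕≡𝟙⇒≡′ y⊕d≡𝟙) y′⊕𝟘≡d

  𝟘⊕x≡x : ∀ x → 𝟘 ⊕ x ≡ just x
  𝟘⊕x≡x x = ⊕-comm (x⊕𝟘≡x x)

  ⊕-complementˡ : ∀ {x y w} → x ⊕ y ≡ just w → w ′ ⊕ x ≡ just (y ′)
  ⊕-complementˡ {x} {y} {w} x⊕y with ⊕-assocʳ x⊕y (x⊕x′≡𝟙 w)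
  ... | d , y⊕w′≡d , x⊕d≡𝟙 with ⊕-assocʳ (subst (λ t → y ⊕ w ′ ≡ just t) (⊕≡𝟙⇒≡′ x⊕d≡𝟙) y⊕w′≡d)
                                          (x′⊕x≡𝟙 x)
  ... | e , w′⊕x≡e , y⊕e≡𝟙 = subst (λ t → w ′ ⊕ x ≡ just t) (⊕≡𝟙⇒≡′ y⊕e≡𝟙) w′⊕x≡e

  ⊕-cancelˡ : ∀ {x y z w} → x ⊕ y ≡ just w → x ⊕ z ≡ just w → y ≡ z
  ⊕-cancelˡ x⊕y x⊕z = ′-injective (just-injective (trans (sym (⊕-complementˡ x⊕y)) (⊕-complementˡ x⊕z)))

  ⊕-positive : ∀ {x y} → x ⊕ y ≡ just 𝟘 → x ≡ 𝟘
  ⊕-positive {x} x⊕y with ⊕-assocʳ x⊕y (𝟘⊕x≡x 𝟙)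
  ... | d , y⊕𝟙≡d , _ with E4 _ d (⊕-comm y⊕𝟙≡d)
  ... | refl = just-injective (trans (sym (x⊕𝟘≡x x)) x⊕y)

  ≤-refl : ∀ x → x ≤ x
  ≤-refl x = 𝟘 , x⊕𝟘≡x x

  𝟘≤ : ∀ x → 𝟘 ≤ x
  𝟘≤ x = x , 𝟘⊕x≡x x

  ≤-antisym : ∀ {x y} → x ≤ y → y ≤ x → x ≡ y
  ≤-antisym {x} (c , x⊕c≡y) (d , y⊕d≡x) with ⊕-assocʳ x⊕c≡y y⊕d≡x
  ... | e , c⊕d≡e , x⊕e≡x with ⊕-cancelˡ x⊕e≡x (x⊕𝟘≡x x)
  ... | refl with ⊕-positive c⊕d≡e
  ... | refl = just-injective (trans (sym (x⊕𝟘≡x x)) x⊕c≡y)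

  x≤y⇒x∨y≡y : ∀ {x y} → x ≤ y → x ∨ y ≡ y
  x≤y⇒x∨y≡y {x} {y} x≤y = ≤-antisym (∨-lub x y y x≤y (≤-refl y)) (∨-ub₂ x y)

  y≤x⇒x∨y≡x : ∀ {x y} → y ≤ x → x ∨ y ≡ x
  y≤x⇒x∨y≡x {x} {y} y≤x = ≤-antisym (∨-lub x y x (≤-refl x) y≤x) (∨-ub₁ x y)

  ⊕-defined⇒≤′ : ∀ {x y z} → x ⊕ y ≡ just z → x ≤ (y ′)
  ⊕-defined⇒≤′ {x} {y} {z} x⊕y with ⊕-assocʳ (⊕-comm x⊕y) (x⊕x′≡𝟙 z)
  ... | d , x⊕z′≡d , y⊕d≡𝟙 = z ′ , subst (λ t → x ⊕ z ′ ≡ just t) (⊕≡𝟙⇒≡′ y⊕d≡𝟙) x⊕z′≡d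

  ≤′⇒⊕-defined : ∀ {x y} → x ≤ (y ′) → ∃ λ z → x ⊕ y ≡ just z
  ≤′⇒⊕-defined {y = y} (c , x⊕c≡y′) with ⊕-assocʳ x⊕c≡y′ (x′⊕x≡𝟙 y)
  ... | d , c⊕y≡d , x⊕d≡𝟙 with ⊕-assocˡ (⊕-comm c⊕y≡d) x⊕d≡𝟙
  ... | z , x⊕y≡z , _ = z , x⊕y≡z

  ≤′-swap : ∀ {x y} → x ≤ (y ′) → y ≤ (x ′)
  ≤′-swap x≤y′ with ≤′⇒⊕-defined x≤y′
  ... | _ , x⊕y = ⊕-defined⇒≤′ (⊕-comm x⊕y)

  Arr-functional : ∀ {x y z z′} → Arr x y z → Arr x y z′ → z ≡ z′
  Arr-functional p q = just-injective (trans (sym p) q)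

  Arr≡𝟙⇔≤ : ∀ {x y} → Arr x y 𝟙 ⇔ x ≤ y
  Arr≡𝟙⇔≤ {x} {y} = mk⇔ to≤ from≤
    where
    to≤ : Arr x y 𝟙 → x ≤ y
    to≤ arr = subst (x ≤_) (′-injective (⊕≡𝟙⇒≡′ arr)) (∨-ub₁ x y)

    from≤ : x ≤ y → Arr x y 𝟙
    from≤ x≤y = subst (λ t → y ⊕ t ′ ≡ just 𝟙) (sym (x≤y⇒x∨y≡y x≤y)) (x⊕x′≡𝟙 y)

  Arr-≥ : ∀ {x y z} → y ≤ x → Arr x y z ⇔ (y ⊕ x ′ ≡ just z)
  Arr-≥ {x} {y} {z} y≤x = mk⇔ (subst P (y≤x⇒x∨y≡x y≤x)) (subst P (sym (y≤x⇒x∨y≡x y≤x)))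
    where
    P : E → Set a
    P t = y ⊕ t ′ ≡ just z

  Arr-′ : ∀ {x y z} → y ≤ (x ′) → Arr (x ′) y z ⇔ (x ⊕ y ≡ just z)
  Arr-′ {x} {y} {z} y≤x′ = mk⇔
    (λ arr → ⊕-comm (subst (λ t → y ⊕ t ≡ just z) (′-involutive x) (to (Arr-≥ y≤x′) arr)))
    (λ x⊕y → from (Arr-≥ y≤x′) (subst (λ t → y ⊕ t ≡ just z) (sym (′-involutive x)) (⊕-comm x⊕y)))

  Arr-x𝟘 : ∀ x → Arr x 𝟘 (x ′)
  Arr-x𝟘 x = from (Arr-≥ (𝟘≤ x)) (𝟘⊕x≡x (x ′))

  Arr-𝟘𝟘 : Arr 𝟘 𝟘 𝟙
  Arr-𝟘𝟘 = from Arr≡𝟙⇔≤ (≤-refl 𝟘)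

  ⊕⇒OplusEL : ∀ {x y z} → x ⊕ y ≡ just z → OplusEL x y z
  ⊕⇒OplusEL {x} {y} x⊕y =
    y ′ , Arr-x𝟘 y , 𝟙 , Arr-𝟘𝟘 , from Arr≡𝟙⇔≤ x≤y′ ,
    x ′ , Arr-x𝟘 x , from (Arr-′ (≤′-swap x≤y′)) x⊕y
    where
    x≤y′ : x ≤ (y ′)
    x≤y′ = ⊕-defined⇒≤′ x⊕y

  OplusEL⇒⊕ : ∀ {x y z} → OplusEL x y z → x ⊕ y ≡ just z
  OplusEL⇒⊕ {x} {y} {z} (s , y→𝟘≡s , e , 𝟘→𝟘≡e , x→s≡e , u , x→𝟘≡u , u→y≡z) =
    to (Arr-′ (≤′-swap (to Arr≡𝟙⇔≤ x→y′≡𝟙))) x′→y≡z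
    where
    x→y′≡𝟙 : Arr x (y ′) 𝟙
    x→y′≡𝟙 = subst₂ (Arr x) (Arr-functional y→𝟘≡s (Arr-x𝟘 y)) (Arr-functional 𝟘→𝟘≡e Arr-𝟘𝟘) x→s≡e

    x′→y≡z : Arr (x ′) y z
    x′→y≡z = subst (λ t → Arr t y z) (Arr-functional x→𝟘≡u (Arr-x𝟘 x)) u→y≡z

  ELIL-identity : ELIL≡id 𝐄
  ELIL-identity = Arr-x𝟘 , Arr-𝟘𝟘 , λ _ _ _ → mk⇔ ⊕⇒OplusEL OplusEL⇒⊕

module LatticeEffectImplicationAlgebraProperties {b} (𝐈 : LatticeEffectImplicationAlgebra b) where
  open LatticeEffectImplicationAlgebra 𝐈
  open ELofEIA 𝐈

  _⊔_ : I → I → I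
  x ⊔ y = (x ⇒ y) ⇒ y

  ⇒≡𝟙⇒y⊔x≡y : ∀ {x y} → x ⇒ y ≡ 𝟙 → y ⊔ x ≡ y
  ⇒≡𝟙⇒y⊔x≡y {x} {y} x⇒y≡𝟙 = ax-ii _ _ (ax-viii y x y (ax-i₂ y) x⇒y≡𝟙) (ax-vi y x)

  ≤EL⇒⇒≡𝟙 : ∀ {x y} → x ≤EL y → x ⇒ y ≡ 𝟙
  ≤EL⇒⇒≡𝟙 {x} {y} (z , x⇒z′≡𝟙 , x′⇒z≡y) = subst (λ t → x ⇒ t ≡ 𝟙) z′⇒x≡y (ax-xii x (z ′))
    where
    z⇒x′≡𝟙 : z ⇒ x ′ ≡ 𝟙
    z⇒x′≡𝟙 = subst (λ t → t ⇒ x ′ ≡ 𝟙) (ax-v z) (ax-iv x (z ′) x⇒z′≡𝟙)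

    z′⇒x≡y : z ′ ⇒ x ≡ y
    z′⇒x≡y = begin
      z ′ ⇒ x        ≡⟨ cong (z ′ ⇒_) (sym (ax-v x)) ⟩
      z ′ ⇒ x ′ ′    ≡⟨ sym (ax-ix z (x ′) z⇒x′≡𝟙) ⟩
      x ′ ⇒ z        ≡⟨ x′⇒z≡y ⟩
      y              ∎

  ⇒≡𝟙⇒≤EL : ∀ {x y} → x ⇒ y ≡ 𝟙 → x ≤EL y
  ⇒≡𝟙⇒≤EL {x} {y} x⇒y≡𝟙 = (y ⇒ x) ′ , x⇒[y⇒x]′′≡𝟙 , x′⇒[y⇒x]′≡y
    where
    x⇒[y⇒x]′′≡𝟙 : x ⇒ (y ⇒ x) ′ ′ ≡ 𝟙
    x⇒[y⇒x]′′≡𝟙 = subst (λ t → x ⇒ t ≡ 𝟙) (sym (ax-v (y ⇒ x))) (ax-xii x y)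

    x′⇒[y⇒x]′≡y : x ′ ⇒ (y ⇒ x) ′ ≡ y
    x′⇒[y⇒x]′≡y = begin
      x ′ ⇒ (y ⇒ x) ′          ≡⟨ cong (λ t → x ′ ⇒ (t ⇒ x) ′) (sym (⇒≡𝟙⇒y⊔x≡y x⇒y≡𝟙)) ⟩
      x ′ ⇒ ((y ⊔ x) ⇒ x) ′    ≡⟨ ax-xi (y ⇒ x) x ⟩
      y ⊔ x                    ≡⟨ ⇒≡𝟙⇒y⊔x≡y x⇒y≡𝟙 ⟩
      y                        ∎

  IsJoin⇒≡⊔ : ∀ {j x y} → IsJoin j x y → j ≡ x ⊔ y
  IsJoin⇒≡⊔ {j} {x} {y} (x≤j , y≤j , least) = ax-ii _ _
    (≤EL⇒⇒≡𝟙 (least (x ⊔ y) (⇒≡𝟙⇒≤EL (ax-vi x y)) (⇒≡𝟙⇒≤EL (ax-vii x y))))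
    (ax-viii x y j (≤EL⇒⇒≡𝟙 x≤j) (≤EL⇒⇒≡𝟙 y≤j))

  ILEL-identity : ILEL≡id 𝐈
  ILEL-identity x y j isJoin = subst (λ t → Sum y (t ′) (x ⇒ y)) (sym (IsJoin⇒≡⊔ isJoin))
    (subst (λ t → y ⇒ t ≡ 𝟙) (sym (ax-v (x ⊔ y))) (ax-vii x y) , ax-xi x y)

theorem2p6 : ∀ {a b}
    → ((𝐄 : LatticeEffectAlgebra a) → ELIL≡id 𝐄)
    × ((𝐈 : LatticeEffectImplicationAlgebra b) → ILEL≡id 𝐈)
theorem2p6 = LatticeEffectAlgebraProperties.ELIL-identity
           , LatticeEffectImplicationAlgebraProperties.ILEL-identity
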